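{- Let $a,b,x$ be non-commuting indeterminates. Define noncommutative polynomials $d_n(a,b,x)$, $n\ge 1$, recursively by $$d_1(a,b,x)=1,\qquad d_n(a,b,x)=d_{n-1}(a,b,x)\,x+\sum_{k=2}^{n-1} d_{n-k}(a,b,x)\,a\,d_k(a,b,x)\,b\quad (n\ge 2),$$ and set $c_n(a,b,x)=a\,d_n(a,b,x)\,b$ for $n\ge1$. Then, in the ring $\mathbb{Z}\langle\langle a,b\rangle\rangle$ of formal power series in the non-commuting variables $a,b$, $$1-\sum_{n=1}^{\infty} c_n(a,b,ab-ba)=\Big(\sum_{n\ge 0} a^n b^n\Big)^{ -1}.$$
   Context: $c_n(a,b,ab-ba)$ denotes the result of substituting $x=ab-ba$ into $c_n(a,b,x)$; it is homogeneous of degree $2n$ in $a,b$, so the infinite sum is a well-defined formal power series. -}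

module Defs where

open import Data.Nat as ℕ using (ℕ; zero; suc; _≤ᵇ_; _∸_)
open import Data.Integer using (ℤ; +_; _+_; _*_; -_; _-_)
open import Data.List using (List; []; _∷_; map; foldr; upTo; length)
open import Data.Product using (_×_; _,_)
open import Data.Bool using (if_then_else_)

data Letter : Set where
  la lb : Letter

Word : Set
Word = List Letter

-- A formal power series in Z<<a,b>> is its coefficient function on words.
Series : Set
Series = Word → ℤ

sumℤ : List ℤ → ℤ
sumℤ = foldr _+_ (+ 0)

0S : Series
0S _ = + 0

1S : Series
1S [] = + 1
1S (_ ∷ _) = + 0

aS : Series
aS (la ∷ []) = + 1
aS _ = + 0

bS : Series
bS (lb ∷ []) = + 1
bS _ = + 0

_+S_ : Series → Series → Series
(f +S g) w = f w + g w

_-S_ : Series → Series → Series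
(f -S g) w = f w - g w

splits : Word → List (Word × Word)
splits [] = ([] , []) ∷ []
splits (l ∷ w) = ([] , l ∷ w) ∷ map (λ { (u , v) → (l ∷ u , v) }) (splits w)

_*S_ : Series → Series → Series
(f *S g) w = sumℤ (map (λ { (u , v) → f u * g v }) (splits w))

infixl 6 _+S_ _-S_
infixl 7 _*S_

ΣS : List ℕ → (ℕ → Series) → Series
ΣS ks f = foldr (λ k s → f k +S s) 0S ks

_^S_ : Series → ℕ → Series
s ^S zero = 1S
s ^S suc n = s ^S n *S s

-- dTable x n k = d_k(a,b,x) for 1 ≤ k ≤ n (evaluated in the series ring,
-- i.e. with the indeterminates a,b,x substituted by aS, bS, x).
-- d_1 = 1,  d_m = d_{m-1} x + Σ_{k=2}^{m-1} d_{m-k} a d_k b  (m ≥ 2).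
dTable : Series → ℕ → ℕ → Series
dTable x zero = λ _ → 0S
dTable x (suc n) k = if k ≤ᵇ n then prev k else new n
  where
  prev : ℕ → Series
  prev = dTable x n
  new : ℕ → Series
  new zero = 1S
  new (suc n') =
    prev (suc n') *S x
      +S ΣS (map (2 ℕ.+_) (upTo n'))
            (λ k → prev (suc (suc n') ∸ k) *S aS *S prev k *S bS)

-- d_n(a,b,x)  (meaningful for n ≥ 1)
d : Series → ℕ → Series
d x n = dTable x n n

c : Series → ℕ → Series
c x n = aS *S d x n *S bS

comm : Series
comm = aS *S bS -S bS *S aS

-- Σ_{n≥1} c_n(a,b,ab-ba): since c_n(a,b,ab-ba) is homogeneous of degree 2n,
-- the coefficient of a word w only receives contributions from n ≤ |w|.
sumC : Series
sumC w = ΣS (map suc (upTo (length w))) (c comm) w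

-- Σ_{n≥0} a^n b^n: likewise only n ≤ |w| contribute to the coefficient of w.
sumAnBn : Series
sumAnBn w = ΣS (upTo (suc (length w))) (λ n → aS ^S n *S bS ^S n) w

-- Write D = Σ_{n≥1} d_n(a,b,ab-ba), so that Σ_{n≥1} c_n = C = aDb.  Summing the
-- defining recursions over all n gives the functional equations
--     A = 1 + aAb,        D = 1 + D(ab-ba) + Da(D-1)b.
-- From these, Y = DbA - Ab satisfies Y = DaYb.  Multiplication by a and b raises
-- the order of a series, so this fixed-point equation forces Y = 0, i.e.
-- aDbA = aAb, whence (1 - C)A = A - aAb = 1.  Finally a left inverse of a series
-- with constant term 1 is automatically a right inverse.

module Submission where

open import Defs
open import Data.Bool using (true; false; if_then_else_)
open import Data.Bool.Properties using (T-≡)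
open import Data.List using (List; []; _∷_; _++_; map; upTo; applyUpTo; length)
open import Data.List.Properties using (length-++; length-++-≤ˡ; length-++-≤ʳ)
open import Data.Nat as ℕ using (ℕ; zero; suc; _≤_; _<_; z≤n; s≤s; _∸_; _≤ᵇ_; _<ᵇ_)
import Data.Nat.Properties as ℕP
open import Data.Nat.Induction using (<-rec)
import Data.Nat.Tactic.RingSolver as ℕSolver
open import Data.Integer using (ℤ; +_; _+_; _*_; _-_)
import Data.Integer.Properties as ℤP
open import Data.Integer.Tactic.RingSolver using (solve-∀)
open import Data.Product using (_×_; _,_; proj₁; proj₂)
open import Data.Sum using (inj₁; inj₂)
open import Function.Bundles using (Equivalence)
open import Relation.Binary.PropositionalEquality
open import Relation.Binary.Bundles using (Setoid)
import Relation.Binary.Reasoning.Setoid as SetoidReasoning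
open import Relation.Nullary using (yes; no)

private
  +-interchange : ∀ a b c d → (a + b) + (c + d) ≡ (a + c) + (b + d)
  +-interchange = solve-∀

  -‿interchange : ∀ a b c d → (a - b) + (c - d) ≡ (a + c) - (b + d)
  -‿interchange = solve-∀

  *-distribʳ-‿ : ∀ x y z → (y - z) * x ≡ y * x - z * x
  *-distribʳ-‿ = solve-∀

  *-distribˡ-‿ : ∀ x y z → x * (y - z) ≡ x * y - x * z
  *-distribˡ-‿ = solve-∀

  assoc-regroup : ∀ x y z P Q → (x * y) * z + (x * P + Q) ≡ x * (y * z + P) + Q
  assoc-regroup = solve-∀

  x+y-x≡y : ∀ x y → (x + y) - x ≡ y
  x+y-x≡y = solve-∀


infix 4 _≈_
_≈_ : Series → Series → Set
f ≈ g = ∀ w → f w ≡ g w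

series-setoid : Setoid _ _
series-setoid = record
  { Carrier = Series ; _≈_ = _≈_
  ; isEquivalence = record
    { refl = λ _ → refl ; sym = λ p w → sym (p w) ; trans = λ p q w → trans (p w) (q w) } }

module ≈-Reasoning = SetoidReasoning series-setoid

≈-sym : ∀ {f g} → f ≈ g → g ≈ f
≈-sym p w = sym (p w)

+-cong : ∀ {f f' g g'} → f ≈ f' → g ≈ g' → f +S g ≈ f' +S g'
+-cong p q w = cong₂ _+_ (p w) (q w)

-‿cong : ∀ {f f' g g'} → f ≈ f' → g ≈ g' → f -S g ≈ f' -S g'
-‿cong p q w = cong₂ _-_ (p w) (q w)

Split : Set
Split = Word × Word

sum-map-+ : ∀ {X : Set} (xs : List X) {F G H : X → ℤ} → (∀ p → H p ≡ F p + G p) →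
            sumℤ (map H xs) ≡ sumℤ (map F xs) + sumℤ (map G xs)
sum-map-+ [] h = refl
sum-map-+ (x ∷ xs) {F} {G} h = trans (cong₂ _+_ (h x) (sum-map-+ xs h)) (+-interchange (F x) (G x) _ _)

sum-map-- : ∀ {X : Set} (xs : List X) {F G H : X → ℤ} → (∀ p → H p ≡ F p - G p) →
            sumℤ (map H xs) ≡ sumℤ (map F xs) - sumℤ (map G xs)
sum-map-- [] h = refl
sum-map-- (x ∷ xs) {F} {G} h = trans (cong₂ _+_ (h x) (sum-map-- xs h)) (-‿interchange (F x) (G x) _ _)

sum-map-scale : ∀ {X : Set} (xs : List X) (c : ℤ) {F H : X → ℤ} → (∀ p → H p ≡ c * F p) →
                sumℤ (map H xs) ≡ c * sumℤ (map F xs)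
sum-map-scale [] c h = sym (ℤP.*-zeroʳ c)
sum-map-scale (x ∷ xs) c {F} h =
  trans (cong₂ _+_ (h x) (sum-map-scale xs c h)) (sym (ℤP.*-distribˡ-+ c (F x) _))

sum-map-zero : ∀ {X : Set} (xs : List X) {H : X → ℤ} → (∀ p → H p ≡ + 0) → sumℤ (map H xs) ≡ + 0
sum-map-zero [] h = refl
sum-map-zero (x ∷ xs) h = cong₂ _+_ (h x) (sum-map-zero xs h)

sum-map-∘ : ∀ (xs : List Split) {φ : Split → Split} {F G : Split → ℤ} →
            (∀ u v → F (φ (u , v)) ≡ G (u , v)) → sumℤ (map F (map φ xs)) ≡ sumℤ (map G xs)
sum-map-∘ [] h = refl
sum-map-∘ ((u , v) ∷ xs) h = cong₂ _+_ (h u v) (sum-map-∘ xs h)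

splits-cong : ∀ w {F G : Split → ℤ} → (∀ u v → u ++ v ≡ w → F (u , v) ≡ G (u , v)) →
              sumℤ (map F (splits w)) ≡ sumℤ (map G (splits w))
splits-cong [] h = cong (_+ + 0) (h [] [] refl)
splits-cong (l ∷ w) {F} {G} h = cong₂ _+_ (h [] (l ∷ w) refl)
  (trans (sum-map-∘ (splits w) {G = λ p → F (l ∷ proj₁ p , proj₂ p)} (λ _ _ → refl))
  (trans (splits-cong w (λ u v e → h (l ∷ u) v (cong (l ∷_) e)))
         (sym (sum-map-∘ (splits w) {G = λ p → G (l ∷ proj₁ p , proj₂ p)} (λ _ _ → refl)))))

splits-zero : ∀ w {F : Split → ℤ} → (∀ u v → u ++ v ≡ w → F (u , v) ≡ + 0) → sumℤ (map F (splits w)) ≡ + 0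
splits-zero w h = trans (splits-cong w {G = λ _ → + 0} h) (sum-map-zero (splits w) (λ _ → refl))

-- The ring laws of ℤ⟨⟨a,b⟩⟩.

*-cong : ∀ {f f' g g'} → f ≈ f' → g ≈ g' → f *S g ≈ f' *S g'
*-cong ef eg w = splits-cong w (λ u v _ → cong₂ _*_ (ef u) (eg v))

*-congˡ : ∀ {f f'} g → f ≈ f' → f *S g ≈ f' *S g
*-congˡ {f} {f'} g ef = *-cong {f} {f'} {g} {g} ef (λ _ → refl)

*-congʳ : ∀ f {g g'} → g ≈ g' → f *S g ≈ f *S g'
*-congʳ f {g} {g'} eg = *-cong {f} {f} {g} {g'} (λ _ → refl) eg

*-distribʳ-+ : ∀ f g h → (f +S g) *S h ≈ f *S h +S g *S h
*-distribʳ-+ f g h w = sum-map-+ (splits w) λ { (u , v) → ℤP.*-distribʳ-+ (h v) (f u) (g u) }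

*-distribˡ-+ : ∀ f g h → f *S (g +S h) ≈ f *S g +S f *S h
*-distribˡ-+ f g h w = sum-map-+ (splits w) λ { (u , v) → ℤP.*-distribˡ-+ (f u) (g v) (h v) }

*-distribʳ-- : ∀ f g h → (f -S g) *S h ≈ f *S h -S g *S h
*-distribʳ-- f g h w = sum-map-- (splits w) λ { (u , v) → *-distribʳ-‿ (h v) (f u) (g u) }

*-distribˡ-- : ∀ f g h → f *S (g -S h) ≈ f *S g -S f *S h
*-distribˡ-- f g h w = sum-map-- (splits w) λ { (u , v) → *-distribˡ-‿ (f u) (g v) (h v) }

*-zeroˡ : ∀ f → 0S *S f ≈ 0S
*-zeroˡ f w = sum-map-zero (splits w) λ { (u , v) → ℤP.*-zeroˡ (f v) }

*-zeroʳ : ∀ f → f *S 0S ≈ 0S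
*-zeroʳ f w = sum-map-zero (splits w) λ { (u , v) → ℤP.*-zeroʳ (f u) }

infix 8 _·_
_·_ : ℤ → Series → Series
(c · f) w = c * f w

·-*-assoc : ∀ c f g → (c · f) *S g ≈ c · (f *S g)
·-*-assoc c f g w = sum-map-scale (splits w) c λ { (u , v) → ℤP.*-assoc c (f u) (g v) }

∂ : Letter → Series → Series
∂ l f u = f (l ∷ u)

-- The constant term of a product, and the product rule for ∂: the first letter
-- of l ∷ w goes either to the right factor (u = []) or to the left one.
*-nil : ∀ f g → (f *S g) [] ≡ f [] * g []
*-nil f g = ℤP.+-identityʳ _

*-cons : ∀ f g l w → (f *S g) (l ∷ w) ≡ f [] * g (l ∷ w) + (∂ l f *S g) w
*-cons f g l w = cong (_+_ (f [] * g (l ∷ w))) (sum-map-∘ (splits w) (λ _ _ → refl))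

∂-* : ∀ l f g → ∂ l (f *S g) ≈ f [] · ∂ l g +S ∂ l f *S g
∂-* l f g = *-cons f g l

-- 1 is a two-sided unit: only the factorisation with empty left (right)
-- factor contributes.
*-identityˡ : ∀ f → 1S *S f ≈ f
*-identityˡ f [] = trans (*-nil 1S f) (ℤP.*-identityˡ (f []))
*-identityˡ f (l ∷ w) =
  trans (*-cons 1S f l w) (trans (cong (_+_ (+ 1 * f (l ∷ w))) (*-zeroˡ f w))
        (trans (ℤP.+-identityʳ _) (ℤP.*-identityˡ (f (l ∷ w)))))

*-identityʳ : ∀ f → f *S 1S ≈ f
*-identityʳ f [] = trans (*-nil f 1S) (ℤP.*-identityʳ (f []))
*-identityʳ f (l ∷ w) =
  trans (*-cons f 1S l w) (trans (cong₂ _+_ (ℤP.*-zeroʳ (f [])) (*-identityʳ (∂ l f) w)) (ℤP.+-identityˡ _))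

-- Associativity, by induction on the word using the product rule.
*-assoc : ∀ f g h → (f *S g) *S h ≈ f *S (g *S h)
*-assoc f g h [] = begin
  (f *S g *S h) []          ≡⟨ trans (*-nil (f *S g) h) (cong (_* h []) (*-nil f g)) ⟩
  (f [] * g []) * h []      ≡⟨ ℤP.*-assoc (f []) (g []) (h []) ⟩
  f [] * (g [] * h [])      ≡⟨ sym (trans (*-nil f (g *S h)) (cong (f [] *_) (*-nil g h))) ⟩
  (f *S (g *S h)) []        ∎
  where open ≡-Reasoning
*-assoc f g h (l ∷ w) = begin
  (f *S g *S h) (l ∷ w)
    ≡⟨ *-cons (f *S g) h l w ⟩
  (f *S g) [] * h (l ∷ w) + (∂ l (f *S g) *S h) w
    ≡⟨ cong₂ _+_ (cong (_* h (l ∷ w)) (*-nil f g)) (*-congˡ h (∂-* l f g) w) ⟩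
  (f [] * g []) * h (l ∷ w) + ((f [] · ∂ l g +S ∂ l f *S g) *S h) w
    ≡⟨ cong (_+_ ((f [] * g []) * h (l ∷ w))) (trans (*-distribʳ-+ (f [] · ∂ l g) (∂ l f *S g) h w)
         (cong₂ _+_ (·-*-assoc (f []) (∂ l g) h w) (*-assoc (∂ l f) g h w))) ⟩
  (f [] * g []) * h (l ∷ w) + (f [] * (∂ l g *S h) w + (∂ l f *S (g *S h)) w)
    ≡⟨ assoc-regroup (f []) (g []) (h (l ∷ w)) _ _ ⟩
  f [] * (g [] * h (l ∷ w) + (∂ l g *S h) w) + (∂ l f *S (g *S h)) w
    ≡⟨ sym (trans (*-cons f (g *S h) l w) (cong (λ z → f [] * z + (∂ l f *S (g *S h)) w) (*-cons g h l w))) ⟩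
  (f *S (g *S h)) (l ∷ w) ∎
  where open ≡-Reasoning

HasOrder : Series → ℕ → Set
HasOrder f k = ∀ u → length u < k → f u ≡ + 0

Agree : ℕ → Series → Series → Set
Agree k f g = ∀ u → length u < k → f u ≡ g u

order-zero : ∀ f → HasOrder f 0
order-zero f u ()

order-mono : ∀ {f j k} → j ≤ k → HasOrder f k → HasOrder f j
order-mono j≤k o u lt = o u (ℕP.<-≤-trans lt j≤k)

order-≈ : ∀ {f g k} → f ≈ g → HasOrder g k → HasOrder f k
order-≈ f≈g o u lt = trans (f≈g u) (o u lt)

order-+ : ∀ {f g k} → HasOrder f k → HasOrder g k → HasOrder (f +S g) k
order-+ of og u lt = cong₂ _+_ (of u lt) (og u lt)

order-- : ∀ {f g k} → HasOrder f k → HasOrder g k → HasOrder (f -S g) k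
order-- of og u lt = cong₂ _-_ (of u lt) (og u lt)

split-bound : ∀ {p q a b} → p ≤ a → a ℕ.+ b < p ℕ.+ q → b < q
split-bound {p} {q} {_} {b} p≤a lt = ℕP.+-cancelˡ-< p b q (ℕP.≤-<-trans (ℕP.+-monoˡ-≤ b p≤a) lt)

-- Orders add under multiplication: each factorisation u ++ v of a short word
-- has |u| < p or |v| < q.
order-* : ∀ {f g} p q → HasOrder f p → HasOrder g q → HasOrder (f *S g) (p ℕ.+ q)
order-* {f} {g} p q of og w lt = splits-zero w vanish
  where
  vanish : ∀ u v → u ++ v ≡ w → f u * g v ≡ + 0
  vanish u v e with length u ℕP.<? p
  ... | yes u<p = trans (cong (_* g v) (of u u<p)) (ℤP.*-zeroˡ (g v))
  ... | no u≮p  = trans (cong (f u *_) (og v v<q)) (ℤP.*-zeroʳ (f u))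
    where
    v<q : length v < q
    v<q = split-bound (ℕP.≮⇒≥ u≮p) (subst (_< p ℕ.+ q) (trans (cong length (sym e)) (length-++ u)) lt)

*-agree : ∀ {k f f' g g'} → Agree k f f' → Agree k g g' → Agree k (f *S g) (f' *S g')
*-agree ef eg w lt = splits-cong w λ u v e →
  cong₂ _*_ (ef u (ℕP.≤-<-trans (subst (λ x → length u ≤ length x) e (length-++-≤ˡ u)) lt))
            (eg v (ℕP.≤-<-trans (subst (λ x → length v ≤ length x) e (length-++-≤ʳ v {u})) lt))

order-unbounded⇒zero : ∀ f → (∀ k → HasOrder f k → HasOrder f (suc k)) → f ≈ 0S
order-unbounded⇒zero f step w = order-≥ (suc (length w)) w ℕP.≤-refl
  where
  order-≥ : ∀ k → HasOrder f k
  order-≥ zero = order-zero f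
  order-≥ (suc k) = step k (order-≥ k)

order-a : HasOrder aS 1
order-a [] _ = refl
order-a (_ ∷ _) (s≤s ())

order-b : HasOrder bS 1
order-b [] _ = refl
order-b (_ ∷ _) (s≤s ())

order-comm : HasOrder comm 2
order-comm = order-- (order-* 1 1 order-a order-b) (order-* 1 1 order-b order-a)

order-pow : ∀ {s} n → HasOrder s 1 → HasOrder (s ^S n) n
order-pow zero o = order-zero _
order-pow (suc n) o = order-mono (ℕP.≤-reflexive (ℕP.+-comm 1 n)) (order-* n 1 (order-pow n o) o)

isum : ℕ → (ℕ → ℤ) → ℤ
isum zero f = + 0
isum (suc n) f = isum n f + f n

isum-cong : ∀ n {f g : ℕ → ℤ} → (∀ i → i < n → f i ≡ g i) → isum n f ≡ isum n g
isum-cong zero h = refl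
isum-cong (suc n) h = cong₂ _+_ (isum-cong n (λ i lt → h i (ℕP.m<n⇒m<1+n lt))) (h n ℕP.≤-refl)

isum-+ : ∀ n (f g : ℕ → ℤ) → isum n (λ i → f i + g i) ≡ isum n f + isum n g
isum-+ zero f g = refl
isum-+ (suc n) f g = trans (cong (_+ (f n + g n)) (isum-+ n f g)) (+-interchange (isum n f) (isum n g) (f n) (g n))

isum-zero : ∀ n {f : ℕ → ℤ} → (∀ i → i < n → f i ≡ + 0) → isum n f ≡ + 0
isum-zero n h = trans (isum-cong n h) (zeros n)
  where
  zeros : ∀ n → isum n (λ _ → + 0) ≡ + 0
  zeros zero = refl
  zeros (suc n) = cong (_+ + 0) (zeros n)

isum-head : ∀ n (f : ℕ → ℤ) → isum (suc n) f ≡ f 0 + isum n (λ i → f (suc i))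
isum-head zero f = ℤP.+-comm (+ 0) (f 0)
isum-head (suc n) f = trans (cong (_+ f (suc n)) (isum-head n f)) (ℤP.+-assoc (f 0) _ (f (suc n)))

isum-extend : ∀ K M (f : ℕ → ℤ) → K ≤ M → (∀ i → K ≤ i → i < M → f i ≡ + 0) → isum M f ≡ isum K f
isum-extend K zero f z≤n h = refl
isum-extend K (suc M) f K≤M h with ℕP.m≤n⇒m<n∨m≡n K≤M
... | inj₂ refl = refl
... | inj₁ (s≤s K≤M') =
  trans (cong₂ _+_ (isum-extend K M f K≤M' (λ i K≤i i<M → h i K≤i (ℕP.m<n⇒m<1+n i<M))) (h M K≤M' ℕP.≤-refl))
        (ℤP.+-identityʳ _)

isum-swap : ∀ n m (g : ℕ → ℕ → ℤ) →
            isum n (λ q → isum m (λ p → g p q)) ≡ isum m (λ p → isum n (λ q → g p q))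
isum-swap zero m g = sym (isum-zero m (λ _ _ → refl))
isum-swap (suc n) m g = trans (cong (_+ isum m (λ p → g p n)) (isum-swap n m g))
  (sym (isum-+ m (λ p → isum n (λ q → g p q)) (λ p → g p n)))

-- Summing over the triangle {(p , q) | p + q < n} row by row or column by column.
isum-triangle : ∀ n (g : ℕ → ℕ → ℤ) →
  isum n (λ m → isum m (λ i → g (m ∸ suc i) i)) ≡ isum n (λ q → isum (n ∸ suc q) (λ p → g p q))
isum-triangle zero g = refl
isum-triangle (suc n) g = begin
  isum n (λ m → isum m (λ i → g (m ∸ suc i) i)) + isum n (λ i → g (n ∸ suc i) i)
    ≡⟨ cong (_+ isum n (λ i → g (n ∸ suc i) i)) (isum-triangle n g) ⟩
  isum n (λ q → isum (n ∸ suc q) (λ p → g p q)) + isum n (λ q → g (n ∸ suc q) q)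
    ≡⟨ sym (isum-+ n (λ q → isum (n ∸ suc q) (λ p → g p q)) (λ q → g (n ∸ suc q) q)) ⟩
  isum n (λ q → isum (suc (n ∸ suc q)) (λ p → g p q))
    ≡⟨ isum-cong n (λ q q<n → cong (λ k → isum k (λ p → g p q)) (sym (ℕP.+-∸-assoc 1 q<n))) ⟩
  isum n (λ q → isum (n ∸ q) (λ p → g p q))
    ≡⟨ sym (trans (cong (λ k → isum n (λ q → isum (n ∸ q) (λ p → g p q)) + isum k (λ p → g p n)) (ℕP.n∸n≡0 n))
                  (ℤP.+-identityʳ _)) ⟩
  isum (suc n) (λ q → isum (suc n ∸ suc q) (λ p → g p q)) ∎
  where open ≡-Reasoning

Σ< : ℕ → (ℕ → Series) → Series
Σ< n F w = isum n (λ i → F i w)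

Σ<-*ʳ : ∀ n (F : ℕ → Series) g → Σ< n F *S g ≈ Σ< n (λ i → F i *S g)
Σ<-*ʳ zero F g = *-zeroˡ g
Σ<-*ʳ (suc n) F g w = trans (*-distribʳ-+ (Σ< n F) (F n) g w) (cong (_+ (F n *S g) w) (Σ<-*ʳ n F g w))

Σ<-*ˡ : ∀ n f (G : ℕ → Series) → f *S Σ< n G ≈ Σ< n (λ i → f *S G i)
Σ<-*ˡ zero f G = *-zeroʳ f
Σ<-*ˡ (suc n) f G w = trans (*-distribˡ-+ f (Σ< n G) (G n) w) (cong (_+ (f *S G n) w) (Σ<-*ˡ n f G w))

order-Σ< : ∀ n {k} (F : ℕ → Series) → (∀ i → i < n → HasOrder (F i) k) → HasOrder (Σ< n F) k
order-Σ< n F h u lt = isum-zero n (λ i i<n → h i i<n u lt)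

ΣS-upTo : ∀ n F w → ΣS (upTo n) F w ≡ Σ< n F w
ΣS-upTo n F w = applyUpTo-sum n (λ i → i)
  where
  applyUpTo-sum : ∀ n (h : ℕ → ℕ) → ΣS (applyUpTo h n) F w ≡ isum n (λ i → F (h i) w)
  applyUpTo-sum zero h = refl
  applyUpTo-sum (suc n) h = trans (cong (_+_ (F (h 0) w)) (applyUpTo-sum n (λ i → h (suc i))))
                                  (sym (isum-head n (λ i → F (h i) w)))

ΣS-map : ∀ (h : ℕ → ℕ) ks F → ΣS (map h ks) F ≈ ΣS ks (λ k → F (h k))
ΣS-map h [] F w = refl
ΣS-map h (k ∷ ks) F w = cong (_+_ (F (h k) w)) (ΣS-map h ks F w)

-- Infinite sums.  A family F is summable when F i has order ≥ i; then only the
-- terms i ≤ |w| contribute to the coefficient of w, and Σ∞ F is their sum.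

Summable : (ℕ → Series) → Set
Summable F = ∀ i → HasOrder (F i) i

Σ∞ : (ℕ → Series) → Series
Σ∞ F w = Σ< (suc (length w)) F w

Σ∞-truncate : ∀ {F} → Summable F → ∀ K → Agree K (Σ∞ F) (Σ< K F)
Σ∞-truncate {F} sF K u u<K =
  sym (isum-extend (suc (length u)) K (λ i → F i u) u<K (λ i u<i _ → sF i u u<i))

Σ∞-cong : ∀ {F G} → (∀ i → F i ≈ G i) → Σ∞ F ≈ Σ∞ G
Σ∞-cong F≈G w = isum-cong (suc (length w)) (λ i _ → F≈G i w)

Σ∞-+ : ∀ F G → Σ∞ (λ i → F i +S G i) ≈ Σ∞ F +S Σ∞ G
Σ∞-+ F G w = isum-+ (suc (length w)) (λ i → F i w) (λ i → G i w)

summable-*ˡ : ∀ {F} f → Summable F → Summable (λ i → f *S F i)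
summable-*ˡ f sF i = order-* 0 i (order-zero f) (sF i)

summable-*ʳ : ∀ {F} g → Summable F → Summable (λ i → F i *S g)
summable-*ʳ g sF i = order-mono (ℕP.m≤m+n i 0) (order-* i 0 (sF i) (order-zero g))

Σ∞-*ʳ : ∀ {F} → Summable F → ∀ g → Σ∞ F *S g ≈ Σ∞ (λ i → F i *S g)
Σ∞-*ʳ {F} sF g w = trans (*-agree (Σ∞-truncate sF N) (λ _ _ → refl) w ℕP.≤-refl) (Σ<-*ʳ N F g w)
  where N = suc (length w)

Σ∞-*ˡ : ∀ {G} → Summable G → ∀ f → f *S Σ∞ G ≈ Σ∞ (λ i → f *S G i)
Σ∞-*ˡ {G} sG f w = trans (*-agree {N} {f} {f} {Σ∞ G} (λ _ _ → refl) (Σ∞-truncate sG N) w ℕP.≤-refl) (Σ<-*ˡ N f G w)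
  where N = suc (length w)

Σ∞-sandwich : ∀ {F} → Summable F → ∀ f g → Σ∞ (λ i → f *S F i *S g) ≈ f *S Σ∞ F *S g
Σ∞-sandwich {F} sF f g = begin
  Σ∞ (λ i → f *S F i *S g)  ≈⟨ ≈-sym (Σ∞-*ʳ (summable-*ˡ f sF) g) ⟩
  Σ∞ (λ i → f *S F i) *S g  ≈⟨ *-congˡ g (≈-sym (Σ∞-*ˡ sF f)) ⟩
  f *S Σ∞ F *S g            ∎
  where open ≈-Reasoning

-- Splitting off the first term; the index shift is harmless because the
-- extra term F (|w| + 1) vanishes at w.
Σ∞-head : ∀ {F} → Summable F → Σ∞ F ≈ F 0 +S Σ∞ (λ i → F (suc i))
Σ∞-head {F} sF w = trans (isum-head n (λ i → F i w)) (cong (_+_ (F 0 w)) (sym tail))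
  where
  n = length w
  tail : Σ∞ (λ i → F (suc i)) w ≡ isum n (λ i → F (suc i) w)
  tail = isum-extend n (suc n) (λ i → F (suc i) w) (ℕP.n≤1+n n) (λ i n≤i _ → sF (suc i) w (s≤s n≤i))

-- Cauchy product: a double sum over (p , q) regrouped by the value of p + q.
Σ∞-cauchy : ∀ (H : ℕ → ℕ → Series) → (∀ p q → HasOrder (H p q) (suc (p ℕ.+ q))) →
            Σ∞ (λ p → Σ∞ (H p)) ≈ Σ∞ (λ m → Σ< m (λ i → H (m ∸ suc i) i))
Σ∞-cauchy H order-H w = sym (begin
  isum N (λ m → isum m (λ i → H (m ∸ suc i) i w))  ≡⟨ isum-triangle N (λ p q → H p q w) ⟩
  isum N (λ q → isum (n ∸ q) (λ p → H p q w))      ≡⟨ isum-cong N (λ q _ → complete q) ⟩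
  isum N (λ q → isum N (λ p → H p q w))            ≡⟨ isum-swap N N (λ p q → H p q w) ⟩
  isum N (λ p → isum N (λ q → H p q w))            ∎)
  where
  open ≡-Reasoning
  n = length w
  N = suc n
  -- the terms with p + q ≥ n are invisible at w
  complete : ∀ q → isum (n ∸ q) (λ p → H p q w) ≡ isum N (λ p → H p q w)
  complete q = sym (isum-extend (n ∸ q) N (λ p → H p q w) (ℕP.≤-trans (ℕP.m∸n≤m n q) (ℕP.n≤1+n n))
    (λ p n∸q≤p _ → order-H p q w (s≤s (ℕP.≤-trans (ℕP.m≤n+m∸n n q)
      (ℕP.≤-trans (ℕP.+-monoʳ-≤ q n∸q≤p) (ℕP.≤-reflexive (ℕP.+-comm q p)))))))

-- The polynomials d_n.  Stage n of the table already holds the final values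
-- d_k for k ≤ n, so the table unfolds to the defining recursion.

≤ᵇ-true : ∀ {k n} → k ≤ n → (k ≤ᵇ n) ≡ true
≤ᵇ-true k≤n = Equivalence.to T-≡ (ℕP.≤⇒≤ᵇ k≤n)

<ᵇ-irrefl : ∀ n → (n <ᵇ n) ≡ false
<ᵇ-irrefl zero = refl
<ᵇ-irrefl (suc n) = <ᵇ-irrefl n

dTable-stable : ∀ x n k → k ≤ n → dTable x n k ≡ d x k
dTable-stable x zero zero z≤n = refl
dTable-stable x (suc n) k k≤1+n with ℕP.m≤n⇒m<n∨m≡n k≤1+n
... | inj₂ refl = refl
... | inj₁ (s≤s k≤n) rewrite ≤ᵇ-true k≤n = dTable-stable x n k k≤n

if-false : ∀ {b} {t f : Series} w → b ≡ false → (if b then t else f) w ≡ f w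
if-false w refl = refl

-- d_{m+2} = d_{m+1} x + Σ_{i<m} d_{m-i} a d_{i+2} b  (the sum over k = i + 2).
d-rec : ∀ x m → d x (suc (suc m)) ≈
        d x (suc m) *S x +S Σ< m (λ i → d x (m ∸ i) *S aS *S d x (suc (suc i)) *S bS)
d-rec x m w = trans (if-false w (<ᵇ-irrefl m)) (cong (_+_ ((d x (suc m) *S x) w)) (begin
  ΣS (map (2 ℕ.+_) (upTo m)) term w         ≡⟨ ΣS-map (2 ℕ.+_) (upTo m) term w ⟩
  ΣS (upTo m) (λ i → term (2 ℕ.+ i)) w      ≡⟨ ΣS-upTo m (λ i → term (2 ℕ.+ i)) w ⟩
  Σ< m (λ i → term (2 ℕ.+ i)) w             ≡⟨ isum-cong m (λ i i<m → cong₂ (λ f g → (f *S aS *S g *S bS) w)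
      (dTable-stable x (suc m) (m ∸ i) (ℕP.≤-trans (ℕP.m∸n≤m m i) (ℕP.n≤1+n m)))
      (dTable-stable x (suc m) (suc (suc i)) (s≤s i<m))) ⟩
  Σ< m (λ i → d x (m ∸ i) *S aS *S d x (suc (suc i)) *S bS) w ∎))
  where
  open ≡-Reasoning
  term : ℕ → Series
  term k = dTable x (suc m) (suc (suc m) ∸ k) *S aS *S dTable x (suc m) k *S bS

-- e m = d_{m+1}(a,b,ab-ba), so that D = Σ_{m≥0} e m; note e 0 = 1.
e : ℕ → Series
e m = d comm (suc m)

quad : ℕ → ℕ → Series
quad p q = e p *S aS *S e (suc q) *S bS

-- The recursion for e, with d_{m-i} = e (m - 1 - i) for i < m.
e-rec : ∀ m → e (suc m) ≈ e m *S comm +S Σ< m (λ i → quad (m ∸ suc i) i)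
e-rec m w = trans (d-rec comm m w) (cong (_+_ ((e m *S comm) w))
  (isum-cong m (λ i i<m → cong (λ k → (d comm k *S aS *S e (suc i) *S bS) w) (ℕP.+-∸-assoc 1 i<m))))

-- quad p q has order ≥ p + q + 2 (its degree in fact is 2(p + q + 2)).
order-quad : ∀ {p q} → HasOrder (e p) p → HasOrder (e (suc q)) (suc q) → HasOrder (quad p q) (suc (suc (p ℕ.+ q)))
order-quad {p} {q} op oq = order-mono bound (order-* _ 1 (order-* _ (suc q) (order-* p 1 op order-a) oq) order-b)
  where
  bound : suc (suc (p ℕ.+ q)) ≤ ((p ℕ.+ 1) ℕ.+ suc q) ℕ.+ 1
  bound = subst (suc (suc (p ℕ.+ q)) ≤_) (sum-eq p q) (ℕP.n≤1+n _)
    where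
    sum-eq : ∀ p q → suc (suc (suc (p ℕ.+ q))) ≡ ((p ℕ.+ 1) ℕ.+ suc q) ℕ.+ 1
    sum-eq = ℕSolver.solve-∀

-- e m has order ≥ m (it is in fact homogeneous of degree 2m), by strong
-- induction along the recursion.
order-e : ∀ m → HasOrder (e m) m
order-e = <-rec (λ m → HasOrder (e m) m) step
  where
  step : ∀ m → (∀ {k} → k < m → HasOrder (e k) k) → HasOrder (e m) m
  step zero _ = order-zero (e 0)
  step (suc m) ih = order-≈ (e-rec m) (order-+ linear-part quadratic-part)
    where
    linear-part : HasOrder (e m *S comm) (suc m)
    linear-part = order-mono (subst (suc m ≤_) (ℕP.+-comm 2 m) (ℕP.n≤1+n (suc m))) (order-* m 2 (ih ℕP.≤-refl) order-comm)
    quadratic-part : HasOrder (Σ< m (λ i → quad (m ∸ suc i) i)) (suc m)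
    quadratic-part = order-Σ< m _ λ i i<m →
      order-mono (ℕP.≤-reflexive (cong suc (sym (trans (sym (ℕP.+-suc (m ∸ suc i) i)) (ℕP.m∸n+n≡m i<m)))))
        (order-quad (ih (s≤s (ℕP.m∸n≤m m (suc i)))) (ih (s≤s i<m)))

-- The series A = Σ_{n≥0} aⁿbⁿ and its functional equation A = 1 + aAb.

P : ℕ → Series
P n = aS ^S n *S bS ^S n

-- aⁿbⁿ has order 2n ≥ n.
summable-P : Summable P
summable-P n = order-mono (ℕP.m≤m+n n n) (order-* n n (order-pow n order-a) (order-pow n order-b))

pow-comm : ∀ s n → s *S s ^S n ≈ s ^S n *S s
pow-comm s zero w = trans (*-identityʳ s w) (sym (*-identityˡ s w))
pow-comm s (suc n) w = trans (sym (*-assoc s (s ^S n) s w)) (*-congˡ s (pow-comm s n) w)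

P-suc : ∀ n → P (suc n) ≈ aS *S P n *S bS
P-suc n = begin
  aS ^S n *S aS *S (bS ^S n *S bS)  ≈⟨ *-congˡ (bS ^S n *S bS) (≈-sym (pow-comm aS n)) ⟩
  aS *S aS ^S n *S (bS ^S n *S bS)  ≈⟨ ≈-sym (*-assoc (aS *S aS ^S n) (bS ^S n) bS) ⟩
  aS *S aS ^S n *S bS ^S n *S bS    ≈⟨ *-congˡ bS (*-assoc aS (aS ^S n) (bS ^S n)) ⟩
  aS *S P n *S bS                   ∎
  where open ≈-Reasoning

A : Series
A = Σ∞ P

sumAnBn≈A : sumAnBn ≈ A
sumAnBn≈A w = ΣS-upTo (suc (length w)) P w

A-equation : A ≈ 1S +S aS *S A *S bS
A-equation = begin
  Σ∞ P                               ≈⟨ Σ∞-head summable-P ⟩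
  P 0 +S Σ∞ (λ n → P (suc n))        ≈⟨ +-cong (*-identityˡ 1S) (Σ∞-cong P-suc) ⟩
  1S +S Σ∞ (λ n → aS *S P n *S bS)   ≈⟨ +-cong {1S} {1S} (λ _ → refl) (Σ∞-sandwich summable-P aS bS) ⟩
  1S +S aS *S A *S bS                ∎
  where open ≈-Reasoning

-- The series D = Σ_{n≥1} d_n(a,b,ab-ba) = Σ∞ e, its functional equation, and
-- C = aDb = Σ_{n≥1} c_n(a,b,ab-ba).

D : Series
D = Σ∞ e

C : Series
C = aS *S D *S bS

summable-e-suc : Summable (λ i → e (suc i))
summable-e-suc i = order-mono (ℕP.n≤1+n i) (order-e (suc i))

D-head : D ≈ 1S +S Σ∞ (λ i → e (suc i))
D-head = Σ∞-head order-e

D-minus-1 : D -S 1S ≈ Σ∞ (λ i → e (suc i))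
D-minus-1 w = trans (cong (_- 1S w) (D-head w)) (x+y-x≡y (1S w) _)

D-quadratic : Σ∞ (λ m → Σ< m (λ i → quad (m ∸ suc i) i)) ≈ D *S aS *S (D -S 1S) *S bS
D-quadratic = begin
  Σ∞ (λ m → Σ< m (λ i → quad (m ∸ suc i) i))
    ≈⟨ ≈-sym (Σ∞-cauchy quad (λ p q → order-mono (ℕP.n≤1+n _) (order-quad (order-e p) (order-e (suc q))))) ⟩
  Σ∞ (λ p → Σ∞ (quad p))
    ≈⟨ Σ∞-cong (λ p → Σ∞-sandwich summable-e-suc (e p *S aS) bS) ⟩
  Σ∞ (λ p → e p *S aS *S Σ∞ (λ i → e (suc i)) *S bS)
    ≈⟨ Σ∞-cong (λ p → *-congˡ bS (*-congʳ (e p *S aS) (≈-sym D-minus-1))) ⟩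
  Σ∞ (λ p → e p *S aS *S (D -S 1S) *S bS)
    ≈⟨ ≈-sym (Σ∞-*ʳ (summable-*ʳ (D -S 1S) (summable-*ʳ aS order-e)) bS) ⟩
  Σ∞ (λ p → e p *S aS *S (D -S 1S)) *S bS
    ≈⟨ *-congˡ bS (≈-sym (Σ∞-*ʳ (summable-*ʳ aS order-e) (D -S 1S))) ⟩
  Σ∞ (λ p → e p *S aS) *S (D -S 1S) *S bS
    ≈⟨ *-congˡ bS (*-congˡ (D -S 1S) (≈-sym (Σ∞-*ʳ order-e aS))) ⟩
  D *S aS *S (D -S 1S) *S bS ∎
  where open ≈-Reasoning

-- Summing e-rec over all m: the linear part gives D(ab - ba).
D-equation : D ≈ 1S +S (D *S comm +S D *S aS *S (D -S 1S) *S bS)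
D-equation = begin
  D
    ≈⟨ D-head ⟩
  1S +S Σ∞ (λ m → e (suc m))
    ≈⟨ +-cong {1S} {1S} (λ _ → refl) (Σ∞-cong e-rec) ⟩
  1S +S Σ∞ (λ m → e m *S comm +S Σ< m (λ i → quad (m ∸ suc i) i))
    ≈⟨ +-cong {1S} {1S} (λ _ → refl) (Σ∞-+ (λ m → e m *S comm) _) ⟩
  1S +S (Σ∞ (λ m → e m *S comm) +S Σ∞ (λ m → Σ< m (λ i → quad (m ∸ suc i) i)))
    ≈⟨ +-cong {1S} {1S} (λ _ → refl) (+-cong (≈-sym (Σ∞-*ʳ order-e comm)) D-quadratic) ⟩
  1S +S (D *S comm +S D *S aS *S (D -S 1S) *S bS) ∎
  where open ≈-Reasoning

order-aeb : ∀ n → HasOrder (aS *S e n *S bS) (suc n)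
order-aeb n = order-mono (ℕP.m≤m+n (suc n) 1) (order-* (suc n) 1 (order-* 1 n order-a (order-e n)) order-b)

-- Σ_{n≥1} c_n(a,b,ab-ba) is C; the sum in the statement stops at n = |w|,
-- which loses nothing since c_{n+1} has order > n.
sumC≈C : sumC ≈ C
sumC≈C w = begin
  sumC w                                  ≡⟨ ΣS-map suc (upTo n) (c comm) w ⟩
  ΣS (upTo n) (λ k → c comm (suc k)) w    ≡⟨ ΣS-upTo n (λ k → c comm (suc k)) w ⟩
  Σ< n (λ k → aS *S e k *S bS) w          ≡⟨ sym (isum-extend n (suc n) (λ k → (aS *S e k *S bS) w) (ℕP.n≤1+n n)
                                                   (λ k n≤k _ → order-aeb k w (s≤s n≤k))) ⟩
  Σ∞ (λ k → aS *S e k *S bS) w            ≡⟨ Σ∞-sandwich order-e aS bS w ⟩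
  C w                                     ∎
  where
  open ≡-Reasoning
  n = length w

-- Rearranging the D-equation with ab - ba = comm:  D(ba) = 1 - D + DaDb.
Dba-equation : D *S (bS *S aS) ≈ 1S -S D +S D *S aS *S D *S bS
Dba-equation w = trans (rearrange (1S w) x y z) (cong (λ t → (1S w - t) + z) (sym expanded))
  where
  x = (D *S (aS *S bS)) w
  y = (D *S (bS *S aS)) w
  z = (D *S aS *S D *S bS) w
  rearrange : ∀ o x y z → y ≡ (o - (o + ((x - y) + (z - x)))) + z
  rearrange = solve-∀
  quadratic : (D *S aS *S (D -S 1S) *S bS) w ≡ z - x
  quadratic = begin
    (D *S aS *S (D -S 1S) *S bS) w
      ≡⟨ *-congˡ bS (*-distribˡ-- (D *S aS) D 1S) w ⟩
    ((D *S aS *S D -S D *S aS *S 1S) *S bS) w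
      ≡⟨ *-distribʳ-- (D *S aS *S D) (D *S aS *S 1S) bS w ⟩
    z - (D *S aS *S 1S *S bS) w
      ≡⟨ cong (z -_) (trans (*-congˡ bS (*-identityʳ (D *S aS)) w) (*-assoc D aS bS w)) ⟩
    z - x ∎
    where open ≡-Reasoning
  expanded : D w ≡ 1S w + ((x - y) + (z - x))
  expanded = trans (D-equation w) (cong (_+_ (1S w)) (cong₂ _+_ (*-distribˡ-- D (aS *S bS) (bS *S aS) w) quadratic))

-- Y = DbA - Ab satisfies Y = DaYb.  The three products DbA, D(ba)(Ab) and
-- D(Ab) are expanded with A = 1 + aAb and D(ba) = 1 - D + DaDb.
Y : Series
Y = D *S bS *S A -S A *S bS

DbA-expand : D *S bS *S A ≈ D *S bS +S D *S (bS *S aS) *S (A *S bS)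
DbA-expand = begin
  D *S bS *S A                                 ≈⟨ *-congʳ (D *S bS) A-equation ⟩
  D *S bS *S (1S +S aS *S A *S bS)             ≈⟨ *-distribˡ-+ (D *S bS) 1S (aS *S A *S bS) ⟩
  D *S bS *S 1S +S D *S bS *S (aS *S A *S bS)  ≈⟨ +-cong (*-identityʳ (D *S bS)) regroup ⟩
  D *S bS +S D *S (bS *S aS) *S (A *S bS)      ∎
  where
  open ≈-Reasoning
  regroup : D *S bS *S (aS *S A *S bS) ≈ D *S (bS *S aS) *S (A *S bS)
  regroup = begin
    D *S bS *S (aS *S A *S bS)    ≈⟨ *-congʳ (D *S bS) (*-assoc aS A bS) ⟩
    D *S bS *S (aS *S (A *S bS))  ≈⟨ ≈-sym (*-assoc (D *S bS) aS (A *S bS)) ⟩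
    D *S bS *S aS *S (A *S bS)    ≈⟨ *-congˡ (A *S bS) (*-assoc D bS aS) ⟩
    D *S (bS *S aS) *S (A *S bS)  ∎

DbaAb-expand : D *S (bS *S aS) *S (A *S bS) ≈ A *S bS -S D *S (A *S bS) +S D *S aS *S D *S bS *S (A *S bS)
DbaAb-expand = begin
  D *S (bS *S aS) *S (A *S bS)
    ≈⟨ *-congˡ (A *S bS) Dba-equation ⟩
  (1S -S D +S D *S aS *S D *S bS) *S (A *S bS)
    ≈⟨ *-distribʳ-+ (1S -S D) (D *S aS *S D *S bS) (A *S bS) ⟩
  (1S -S D) *S (A *S bS) +S D *S aS *S D *S bS *S (A *S bS)
    ≈⟨ +-cong (*-distribʳ-- 1S D (A *S bS)) (λ _ → refl) ⟩
  1S *S (A *S bS) -S D *S (A *S bS) +S D *S aS *S D *S bS *S (A *S bS)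
    ≈⟨ +-cong (-‿cong (*-identityˡ (A *S bS)) (λ _ → refl)) (λ _ → refl) ⟩
  A *S bS -S D *S (A *S bS) +S D *S aS *S D *S bS *S (A *S bS) ∎
  where open ≈-Reasoning

DAb-expand : D *S (A *S bS) ≈ D *S bS +S D *S (aS *S A *S bS *S bS)
DAb-expand = begin
  D *S (A *S bS)                                ≈⟨ *-congʳ D (*-congˡ bS A-equation) ⟩
  D *S ((1S +S aS *S A *S bS) *S bS)            ≈⟨ *-congʳ D (*-distribʳ-+ 1S (aS *S A *S bS) bS) ⟩
  D *S (1S *S bS +S aS *S A *S bS *S bS)        ≈⟨ *-distribˡ-+ D (1S *S bS) (aS *S A *S bS *S bS) ⟩
  D *S (1S *S bS) +S D *S (aS *S A *S bS *S bS) ≈⟨ +-cong (*-congʳ D (*-identityˡ bS)) (λ _ → refl) ⟩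
  D *S bS +S D *S (aS *S A *S bS *S bS)         ∎
  where open ≈-Reasoning

DaYb-expand : D *S (aS *S Y *S bS) ≈ D *S aS *S D *S bS *S (A *S bS) -S D *S (aS *S A *S bS *S bS)
DaYb-expand = begin
  D *S (aS *S Y *S bS)
    ≈⟨ *-congʳ D (*-congˡ bS (*-distribˡ-- aS (D *S bS *S A) (A *S bS))) ⟩
  D *S ((aS *S (D *S bS *S A) -S aS *S (A *S bS)) *S bS)
    ≈⟨ *-congʳ D (*-distribʳ-- (aS *S (D *S bS *S A)) (aS *S (A *S bS)) bS) ⟩
  D *S (aS *S (D *S bS *S A) *S bS -S aS *S (A *S bS) *S bS)
    ≈⟨ *-distribˡ-- D (aS *S (D *S bS *S A) *S bS) (aS *S (A *S bS) *S bS) ⟩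
  D *S (aS *S (D *S bS *S A) *S bS) -S D *S (aS *S (A *S bS) *S bS)
    ≈⟨ -‿cong right-nest (*-congʳ D (*-congˡ bS (≈-sym (*-assoc aS A bS)))) ⟩
  D *S aS *S D *S bS *S (A *S bS) -S D *S (aS *S A *S bS *S bS) ∎
  where
  open ≈-Reasoning
  right-nest : D *S (aS *S (D *S bS *S A) *S bS) ≈ D *S aS *S D *S bS *S (A *S bS)
  right-nest = begin
    D *S (aS *S (D *S bS *S A) *S bS)      ≈⟨ *-congʳ D (*-assoc aS (D *S bS *S A) bS) ⟩
    D *S (aS *S (D *S bS *S A *S bS))      ≈⟨ *-congʳ D (*-congʳ aS (*-assoc (D *S bS) A bS)) ⟩
    D *S (aS *S (D *S bS *S (A *S bS)))    ≈⟨ *-congʳ D (*-congʳ aS (*-assoc D bS (A *S bS))) ⟩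
    D *S (aS *S (D *S (bS *S (A *S bS))))  ≈⟨ ≈-sym (*-assoc D aS _) ⟩
    D *S aS *S (D *S (bS *S (A *S bS)))    ≈⟨ ≈-sym (*-assoc (D *S aS) D _) ⟩
    D *S aS *S D *S (bS *S (A *S bS))      ≈⟨ ≈-sym (*-assoc (D *S aS *S D) bS (A *S bS)) ⟩
    D *S aS *S D *S bS *S (A *S bS)        ∎

-- With M = DaDb(Ab) and N = D(aAbb):  DbA = Db + Ab - (Db + N) + M  and
-- DaYb = M - N, so Y = DbA - Ab = DaYb.
Y-fixed-point : Y ≈ D *S (aS *S Y *S bS)
Y-fixed-point w = begin
  (D *S bS *S A) w - (A *S bS) w
    ≡⟨ cong (_- (A *S bS) w) (trans (DbA-expand w) (cong (_+_ ((D *S bS) w))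
         (trans (DbaAb-expand w) (cong (λ t → ((A *S bS) w - t) + M w) (DAb-expand w))))) ⟩
  ((D *S bS) w + (((A *S bS) w - ((D *S bS) w + N w)) + M w)) - (A *S bS) w
    ≡⟨ cancel ((D *S bS) w) ((A *S bS) w) (M w) (N w) ⟩
  M w - N w
    ≡⟨ sym (DaYb-expand w) ⟩
  (D *S (aS *S Y *S bS)) w ∎
  where
  open ≡-Reasoning
  M = D *S aS *S D *S bS *S (A *S bS)
  N = D *S (aS *S A *S bS *S bS)
  cancel : ∀ db ab m n → (db + ((ab - (db + n)) + m)) - ab ≡ m - n
  cancel = solve-∀

-- Multiplying by a and b raises the order, so the fixed-point equation forces Y = 0.
Y≈0 : Y ≈ 0S
Y≈0 = order-unbounded⇒zero Y λ k order-Y →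
  order-≈ Y-fixed-point (order-mono (ℕP.m≤m+n (suc k) 1)
    (order-* 0 _ (order-zero D) (order-* (suc k) 1 (order-* 1 k order-a order-Y) order-b)))

-- Hence (1 - C)A = A - aDbA = 1 + aAb - aDbA = 1 - aY = 1.
left-inverse : (1S -S C) *S A ≈ 1S
left-inverse w = begin
  ((1S -S C) *S A) w
    ≡⟨ *-distribʳ-- 1S C A w ⟩
  (1S *S A) w - (C *S A) w
    ≡⟨ cong₂ _-_ (trans (*-identityˡ A w) (A-equation w)) CA≈aAb ⟩
  (1S w + (aS *S A *S bS) w) - (aS *S A *S bS) w
    ≡⟨ x+y-y≡x (1S w) _ ⟩
  1S w ∎
  where
  open ≡-Reasoning
  x+y-y≡x : ∀ x y → (x + y) - y ≡ x
  x+y-y≡x = solve-∀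
  aY≈0 : (aS *S (D *S bS *S A)) w - (aS *S (A *S bS)) w ≡ + 0
  aY≈0 = trans (sym (*-distribˡ-- aS (D *S bS *S A) (A *S bS) w)) (trans (*-congʳ aS Y≈0 w) (*-zeroʳ aS w))
  CA≈aAb : (C *S A) w ≡ (aS *S A *S bS) w
  CA≈aAb = trans (trans (*-assoc (aS *S D) bS A w) (trans (*-assoc aS D (bS *S A) w) (sym (*-congʳ aS (*-assoc D bS A) w))))
                 (trans (ℤP.i-j≡0⇒i≡j _ _ aY≈0) (sym (*-assoc aS A bS w)))

-- A left inverse of a series S with constant term 1 is also a right inverse:
-- X = SL - 1 satisfies XS = S(LS) - S = 0, so X = X(1 - S) has unbounded order.
left⇒right-inverse : ∀ {L S} → HasOrder (1S -S S) 1 → L *S S ≈ 1S → S *S L ≈ 1S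
left⇒right-inverse {L} {S} order-1-S LS≈1 w = ℤP.i-j≡0⇒i≡j _ _ (X≈0 w)
  where
  X = S *S L -S 1S
  XS≈0 : X *S S ≈ 0S
  XS≈0 v = trans (*-distribʳ-- (S *S L) 1S S v)
    (trans (cong₂ _-_ (trans (*-assoc S L S v) (trans (*-congʳ S LS≈1 v) (*-identityʳ S v))) (*-identityˡ S v))
           (ℤP.+-inverseʳ (S v)))
  X-fixed : X ≈ X *S (1S -S S)
  X-fixed v = sym (trans (*-distribˡ-- X 1S S v) (trans (cong₂ _-_ (*-identityʳ X v) (XS≈0 v)) (ℤP.+-identityʳ (X v))))
  X≈0 : X ≈ 0S
  X≈0 = order-unbounded⇒zero X λ k order-X →
    order-≈ X-fixed (order-mono (ℕP.≤-reflexive (ℕP.+-comm 1 k)) (order-* k 1 order-X order-1-S))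

order-1-sumAnBn : HasOrder (1S -S sumAnBn) 1
order-1-sumAnBn [] _ = refl
order-1-sumAnBn (_ ∷ _) (s≤s ())

theorem1 : (w : Word) → ((1S -S sumC) *S sumAnBn) w ≡ 1S w × (sumAnBn *S (1S -S sumC)) w ≡ 1S w
theorem1 w = left w , left⇒right-inverse order-1-sumAnBn left w
  where
  left : (1S -S sumC) *S sumAnBn ≈ 1S
  left v = trans (*-cong (-‿cong {1S} {1S} (λ _ → refl) sumC≈C) sumAnBn≈A v) (left-inverse v)
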